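{- Let $\mathcal{T}^*$ be a hierarchical clustering of $\mathcal{X}$, let $Y\subseteq\mathcal{X}$ with $|Y|\ge 2$, let $x\in\mathcal{X}\setminus Y$, and let $\mathcal{T}=\mathcal{T}^*[Y]$. Let $\bar v$ be the sibling of $x$ in $\mathcal{T}$ (defined in the context). Let $v$ be an internal node of $\mathcal{T}$, and let $x_L$, $x_R$ be leaves of $\mathcal{T}$ in the subtrees rooted at the left and right child of $v$, respectively. Consider the response to the ordinal query $\{x_L,x_R,x\}$ (with respect to $\mathcal{T}^*$). If the response is $\{x_L,x\}$, then $\bar v$ lies in the subtree rooted at the left child of $v$. If the response is $\{x_R,x\}$, then $\bar v$ lies in the subtree rooted at the right child of $v$. If the response is $\{x_L,x_R\}$, then $\bar v$ lies in neither of these two subtrees (i.e., $\bar v$ is $v$ or lies outside the subtree rooted at $v$).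
   Context: A hierarchical clustering of $\mathcal{X}$ is a rooted tree whose leaves are exactly the elements of $\mathcal{X}$ and in which every internal node has exactly two children; the cluster of a node is the set of leaves in its subtree. The ordinal query $\{x,x',x''\}$ returns the unique pair among the three which is contained in some cluster of $\mathcal{T}^*$ not containing the third element. For $S\subseteq\mathcal{X}$ with $|S|\ge2$, the induced tree $\mathcal{T}^*[S]$ is obtained by deleting leaves not in $S$, repeatedly deleting childless internal nodes, and contracting nodes with a single child (a root with a single child is removed). Sibling: in $\mathcal{T}^*[Y\cup\{x\}]$ the leaf $x$ has a sibling node, whose cluster $C\subseteq Y$ is also a cluster of $\mathcal{T}^*[Y]$; the node of $\mathcal{T}=\mathcal{T}^*[Y]$ with cluster $C$ is called the sibling $\bar v$ of $x$ in $\mathcal{T}$ (the correct location of $x$). -}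

module Defs where

open import Data.List using (List; []; _∷_; _++_)
open import Data.List.Membership.Propositional using (_∈_)
open import Data.List.Membership.DecPropositional using () renaming (_∈?_ to dec∈)
open import Data.Maybe using (Maybe; just; nothing)
open import Data.Product using (Σ; ∃; ∃₂; _×_; _,_)
open import Data.Sum using (_⊎_)
open import Relation.Binary.Definitions using (DecidableEquality)
open import Relation.Binary.PropositionalEquality using (_≡_)
open import Relation.Nullary using (¬_; yes; no)

data Tree (A : Set) : Set where
  leaf : A → Tree A
  node : Tree A → Tree A → Tree A

-- list of leaf labels (the cluster of the tree's root)
leaves : {A : Set} → Tree A → List A
leaves (leaf a)   = a ∷ []
leaves (node l r) = leaves l ++ leaves r

-- Nodes are addressed by paths from the root.
data Dir : Set where
  L R : Dir

Path : Set
Path = List Dir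

subtreeAt : {A : Set} → Tree A → Path → Maybe (Tree A)
subtreeAt t          []      = just t
subtreeAt (leaf _)   (_ ∷ _) = nothing
subtreeAt (node l _) (L ∷ p) = subtreeAt l p
subtreeAt (node _ r) (R ∷ p) = subtreeAt r p

-- p is a prefix of q : node q lies in the subtree rooted at node p
_≼_ : Path → Path → Set
p ≼ q = ∃ λ s → p ++ s ≡ q

-- Induced tree T[S]: delete leaves not in S, delete childless internal
-- nodes, contract single-child nodes.  nothing = empty result.
combine : {A : Set} → Maybe (Tree A) → Maybe (Tree A) → Maybe (Tree A)
combine (just l) (just r) = just (node l r)
combine (just l) nothing  = just l
combine nothing  (just r) = just r
combine nothing  nothing  = nothing

restrict : {A : Set} → DecidableEquality A → List A → Tree A → Maybe (Tree A)
restrict _≟_ S (leaf a) with dec∈ _≟_ a S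
... | yes _ = just (leaf a)
... | no  _ = nothing
restrict _≟_ S (node l r) = combine (restrict _≟_ S l) (restrict _≟_ S r)

-- Ordinal query response {a,b} for the triple {a,b,c} w.r.t. T:
-- some cluster of T contains a and b but not c.
Response : {A : Set} → Tree A → A → A → A → Set
Response {A} T a b c =
  Σ Path λ p → Σ (Tree A) λ S →
    subtreeAt T p ≡ just S × a ∈ leaves S × b ∈ leaves S × ¬ (c ∈ leaves S)

SiblingOf : {A : Set} → A → Tree A → Tree A → Set
SiblingOf x s T = ∃ λ q →
  (subtreeAt T q ≡ just (node (leaf x) s)) ⊎ (subtreeAt T q ≡ just (node s (leaf x)))

SameSet : {A : Set} → List A → List A → Set
SameSet xs ys = (∀ {a} → a ∈ xs → a ∈ ys) × (∀ {a} → a ∈ ys → a ∈ xs)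

-- Nodes are addressed by paths, and "a is under p" means that the leaf a is in
-- the cluster of node p.  Since T* has distinct leaves its clusters are
-- laminar: clusters sharing a leaf are nested, sibling clusters are disjoint,
-- and cluster inclusion forces the prefix order.  Restricting to Y keeps
-- exactly the leaves in Y, so nodes of T = T*[Y] lift to nodes of T*; in
-- particular v lifts to a node w of T*, and the sibling configuration of x in
-- T*[Y ∪ {x}] lifts to a node pu of T* with x on one side and s on the other.
-- Every cluster holding x and an element of Y lies above pu.  An answer
-- {x_d, x} gives a cluster inside the d-child of w containing x, so that child
-- lies above pu and contains s.  An answer {x_L, x_R} rules this out: a child
-- of w containing s would either contain x or force x_{d̄} into s.  Cluster
-- inclusion in T then yields the prefix statements of the theorem.

module Submission where

open import Data.Empty using (⊥; ⊥-elim)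
open import Data.List using (List; []; _∷_; _∷ʳ_; _++_; filter)
open import Data.List.Properties using (++-assoc; ++-identityʳ; ++-cancelˡ; ∷-injective; ∷-injectiveˡ; filter-++)
open import Data.List.Membership.Propositional using (_∈_; _∉_)
open import Data.List.Membership.Propositional.Properties using (∈-++⁻; ∈-++⁺ˡ; ∈-++⁺ʳ; ∈-filter⁺; ∈-filter⁻)
open import Data.List.Membership.DecPropositional using () renaming (_∈?_ to dec∈)
open import Data.List.Relation.Unary.Any using (here; there)
open import Data.List.Relation.Unary.All using () renaming (lookup to All-lookup)
open import Data.List.Relation.Unary.All.Properties using () renaming (++⁻ˡ to All-++⁻ˡ; ++⁻ʳ to All-++⁻ʳ)
open import Data.List.Relation.Unary.AllPairs using ([]; _∷_)
open import Data.List.Relation.Unary.Unique.Propositional using (Unique)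
open import Data.List.Relation.Unary.Unique.Propositional.Properties using (filter⁺)
open import Data.Maybe using (Maybe; just; nothing)
open import Data.Product using (∃; ∃₂; _×_; _,_; proj₁; proj₂) renaming (map to ×-map; map₁ to ×-map₁; map₂ to ×-map₂)
open import Data.Sum using (_⊎_; inj₁; inj₂; swap) renaming (map to ⊎-map)
open import Function using (_∘_)
open import Relation.Binary.Definitions using (DecidableEquality)
open import Relation.Binary.PropositionalEquality
open import Relation.Nullary using (¬_; yes; no)

open import Defs

private
  variable
    A : Set
    a b c x : A
    d : Dir
    p q w pv z : Path
    t T S S' l r l' r' s : Tree A
    Y : List A

flip : Dir → Dir
flip L = R
flip R = L

flip-≢ : ∀ d → flip d ≢ d
flip-≢ L ()
flip-≢ R ()

≼-refl : p ≼ p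
≼-refl {p = p} = [] , ++-identityʳ p

≼-cons : p ≼ q → (d ∷ p) ≼ (d ∷ q)
≼-cons {d = d} (z , e) = z , cong (d ∷_) e

parent-≼ : ∀ p d → p ≼ (p ∷ʳ d)
parent-≼ p d = d ∷ [] , refl

prefixes-comparable : ∀ p q → p ++ z ≡ q ++ w → p ≼ q ⊎ q ≼ p
prefixes-comparable []      q        _ = inj₁ (q , refl)
prefixes-comparable (d ∷ p) []       _ = inj₂ (d ∷ p , refl)
prefixes-comparable (d ∷ p) (_ ∷ q) e with ∷-injective e
... | refl , e′ = ⊎-map ≼-cons ≼-cons (prefixes-comparable p q e′)

≼-snoc : ∀ q p d → q ≼ (p ∷ʳ d) → q ≼ p ⊎ q ≡ p ∷ʳ d
≼-snoc []              p        d _        = inj₁ (p , refl)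
≼-snoc (e ∷ [])        []       d (_ , eq) = inj₂ (cong (_∷ []) (∷-injectiveˡ eq))
≼-snoc (_ ∷ _ ∷ _)     []       d (_ , ())
≼-snoc (e ∷ q)         (_ ∷ p)  d (z , eq) with ∷-injective eq
... | refl , eq′ = ⊎-map ≼-cons (cong (e ∷_)) (≼-snoc q p d (z , eq′))

≼-children : ∀ p {d d′} → (p ∷ʳ d) ≼ (p ∷ʳ d′) → d ≡ d′
≼-children p {d} (z , e) =
  ∷-injectiveˡ (++-cancelˡ p (d ∷ z) _ (trans (sym (++-assoc p (d ∷ []) z)) e))

subtreeAt-++ : ∀ p → subtreeAt t p ≡ just S → subtreeAt t (p ++ q) ≡ subtreeAt S q
subtreeAt-++ {t = t}        []      refl = refl
subtreeAt-++ {t = leaf _}   (_ ∷ _) ()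
subtreeAt-++ {t = node l r} (L ∷ p) e    = subtreeAt-++ p e
subtreeAt-++ {t = node l r} (R ∷ p) e    = subtreeAt-++ p e

branch : Dir → Tree A → Tree A → Tree A
branch L l r = l
branch R l r = r

child-at : subtreeAt t p ≡ just (node l r) → ∀ d → subtreeAt t (p ∷ʳ d) ≡ just (branch d l r)
child-at {p = p} e L = subtreeAt-++ p e
child-at {p = p} e R = subtreeAt-++ p e

ancestor-is-node : ∀ p → subtreeAt t (p ++ d ∷ q) ≡ just S → ∃₂ λ l r → subtreeAt t p ≡ just (node l r)
ancestor-is-node {t = leaf _}   []      ()
ancestor-is-node {t = node l r} []      _ = l , r , refl
ancestor-is-node {t = leaf _}   (_ ∷ _) ()
ancestor-is-node {t = node l r} (L ∷ p) e = ancestor-is-node p e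
ancestor-is-node {t = node l r} (R ∷ p) e = ancestor-is-node p e

some-leaf : ∀ (S : Tree A) → ∃ λ a → a ∈ leaves S
some-leaf (leaf a)   = a , here refl
some-leaf (node l r) = ×-map₂ ∈-++⁺ˡ (some-leaf l)

data Under (t : Tree A) (p : Path) (a : A) : Set where
  under : ∀ z → subtreeAt t (p ++ z) ≡ just (leaf a) → Under t p a

leaf-address : ∀ S → a ∈ leaves S → ∃ λ z → subtreeAt S z ≡ just (leaf a)
leaf-address (leaf _)   (here refl) = [] , refl
leaf-address (node l r) m with ∈-++⁻ (leaves l) m
... | inj₁ m′ = let z , e = leaf-address l m′ in L ∷ z , e
... | inj₂ m′ = let z , e = leaf-address r m′ in R ∷ z , e

address-leaf : ∀ z → subtreeAt S z ≡ just (leaf a) → a ∈ leaves S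
address-leaf {S = S}        []      refl = here refl
address-leaf {S = leaf _}   (_ ∷ _) ()
address-leaf {S = node l r} (L ∷ z) e    = ∈-++⁺ˡ (address-leaf z e)
address-leaf {S = node l r} (R ∷ z) e    = ∈-++⁺ʳ (leaves l) (address-leaf z e)

under⁺ : subtreeAt t p ≡ just S → a ∈ leaves S → Under t p a
under⁺ {p = p} {S = S} e m with leaf-address S m
... | z , e′ = under z (trans (subtreeAt-++ p e) e′)

under⁻ : subtreeAt t p ≡ just S → Under t p a → a ∈ leaves S
under⁻ {p = p} e (under z e′) = address-leaf z (trans (sym (subtreeAt-++ p e)) e′)

Under-mono : p ≼ q → Under t q a → Under t p a
Under-mono {p = p} {t = t} {a = a} (z₀ , refl) (under z e) =
  under (z₀ ++ z) (subst (λ y → subtreeAt t y ≡ just (leaf a)) (++-assoc p z₀ z) e)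

Under-parent : Under t (p ∷ʳ d) a → Under t p a
Under-parent {p = p} {d = d} = Under-mono (parent-≼ p d)

some-leaf-under : subtreeAt t p ≡ just S → ∃ (Under t p)
some-leaf-under {S = S} e = ×-map₂ (under⁺ e) (some-leaf S)

parent-is-node : Under t (p ∷ʳ d) a → ∃₂ λ l r → subtreeAt t p ≡ just (node l r)
parent-is-node {t = t} {p = p} {d = d} {a = a} (under z e) =
  ancestor-is-node p (subst (λ y → subtreeAt t y ≡ just (leaf a)) (++-assoc p (d ∷ []) z) e)

Under-children : subtreeAt t p ≡ just (node l r) → Under t p a → Under t (p ∷ʳ L) a ⊎ Under t (p ∷ʳ R) a
Under-children {t = t} {p = p} {l = l} e a∈p =
  ⊎-map (under⁺ (child-at {t = t} {p = p} e L)) (under⁺ (child-at {t = t} {p = p} e R))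
        (∈-++⁻ (leaves l) (under⁻ e a∈p))

Under-sides : Under t (p ∷ʳ d) c → Under t p a → Under t (p ∷ʳ d) a ⊎ Under t (p ∷ʳ flip d) a
Under-sides {d = L} c∈pd a∈p = Under-children (proj₂ (proj₂ (parent-is-node c∈pd))) a∈p
Under-sides {d = R} c∈pd a∈p = swap (Under-children (proj₂ (proj₂ (parent-is-node c∈pd))) a∈p)

response-cluster : Response t a b c → ∃ λ p → Under t p a × Under t p b × ¬ Under t p c
response-cluster (p , _ , e , a∈ , b∈ , c∉) = p , under⁺ e a∈ , under⁺ e b∈ , c∉ ∘ under⁻ e

response-swap : Response t a b c → Response t b a c
response-swap (p , S , e , a∈ , b∈ , c∉) = p , S , e , b∈ , a∈ , c∉

-- Laminarity of the clusters of a tree with distinct leaves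

unique-++ : ∀ xs {ys : List A} → Unique (xs ++ ys) → Unique xs × Unique ys × (∀ {a} → a ∈ xs → a ∉ ys)
unique-++ []       u        = [] , u , λ ()
unique-++ (x ∷ xs) (x∉ ∷ u) with unique-++ xs u
... | uxs , uys , disjoint =
  All-++⁻ˡ xs x∉ ∷ uxs , uys ,
  λ { (here refl) m → All-lookup (All-++⁻ʳ xs x∉) m refl ; (there a∈) → disjoint a∈ }

unique-address : Unique (leaves t) → ∀ z z′ → subtreeAt t z ≡ just (leaf a) → subtreeAt t z′ ≡ just (leaf a) → z ≡ z′
unique-address {t = leaf _}   _ []      []       _  _  = refl
unique-address {t = leaf _}   _ []      (_ ∷ _)  _  ()
unique-address {t = leaf _}   _ (_ ∷ _) _        () _
unique-address {t = node _ _} _ []      _        () _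
unique-address {t = node _ _} _ (_ ∷ _) []       _  ()
unique-address {t = node l r} u (d ∷ z) (d′ ∷ z′) e e′ with unique-++ (leaves l) u | d | d′
... | ul , _  , _        | L | L = cong (L ∷_) (unique-address ul z z′ e e′)
... | _  , ur , _        | R | R = cong (R ∷_) (unique-address ur z z′ e e′)
... | _  , _  , disjoint | L | R = ⊥-elim (disjoint (address-leaf z e) (address-leaf z′ e′))
... | _  , _  , disjoint | R | L = ⊥-elim (disjoint (address-leaf z′ e′) (address-leaf z e))

Under-comparable : Unique (leaves t) → Under t p a → Under t q a → p ≼ q ⊎ q ≼ p
Under-comparable u (under z e) (under z′ e′) = prefixes-comparable _ _ (unique-address u _ _ e e′)

branches-disjoint : Unique (leaves t) → Under t (p ∷ʳ d) a → Under t (p ∷ʳ flip d) a → ⊥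
branches-disjoint {p = p} {d = d} u i j with Under-comparable u i j
... | inj₁ h = flip-≢ d (sym (≼-children p h))
... | inj₂ h = flip-≢ d (≼-children p h)

child-comparable : Unique (leaves t) → Under t (p ∷ʳ d) a → Under t q a → (p ∷ʳ d) ≼ q ⊎ q ≼ p
child-comparable {p = p} {d = d} {q = q} u i j with Under-comparable u i j
... | inj₁ h = inj₁ h
... | inj₂ h with ≼-snoc q p d h
...   | inj₁ q≼p = inj₂ q≼p
...   | inj₂ refl = inj₁ ≼-refl

separating-cluster : Unique (leaves t) → Under t (w ∷ʳ d) a → Under t w b →
  Under t p a → ¬ Under t p b → (w ∷ʳ d) ≼ p
separating-cluster u a∈wd b∈w a∈p b∉p with child-comparable u a∈wd a∈p
... | inj₁ wd≼p = wd≼p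
... | inj₂ p≼w  = ⊥-elim (b∉p (Under-mono p≼w b∈w))

joint-cluster-above : Unique (leaves t) → Under t (w ∷ʳ d) a → Under t (w ∷ʳ flip d) b →
  Under t p a → Under t p b → p ≼ w
joint-cluster-above u a∈wd b∈wd̄ a∈p b∈p with child-comparable u a∈wd a∈p
... | inj₁ wd≼p = ⊥-elim (branches-disjoint u (Under-mono wd≼p b∈p) b∈wd̄)
... | inj₂ p≼w  = p≼w

sibling-leaf : Under t (p ∷ʳ d) a → ∃ (Under t (p ∷ʳ flip d))
sibling-leaf {t = t} {p = p} {d = d} a∈pd with parent-is-node a∈pd
... | _ , _ , e = some-leaf-under (child-at {t = t} {p = p} e (flip d))

cluster-⊆⇒≼ : Unique (leaves t) → subtreeAt t p ≡ just S → (∀ {a} → Under t p a → Under t q a) → q ≼ p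
cluster-⊆⇒≼ {t = t} {p = p} {q = q} u eS p⊆q with some-leaf-under eS
... | a , a∈p with Under-comparable u a∈p (p⊆q a∈p)
...   | inj₂ q≼p           = q≼p
...   | inj₁ ([] , e)      = [] , trans (++-identityʳ q) (trans (sym e) (++-identityʳ p))
...   | inj₁ (d ∷ z , refl) =
  let b , b∈pd̄ = sibling-leaf (inside-child (p⊆q a∈p))
  in ⊥-elim (branches-disjoint u (inside-child (p⊆q (Under-parent b∈pd̄))) b∈pd̄)
  where
  -- q = p ++ d ∷ z lies inside the child p ∷ʳ d, yet contains the whole cluster of p
  inside-child : ∀ {b} → Under t (p ++ d ∷ z) b → Under t (p ∷ʳ d) b
  inside-child = Under-mono (z , ++-assoc p (d ∷ []) z)

-- Restriction to a set of labels

module Restriction (_≟_ : DecidableEquality A) where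

  leavesM : Maybe (Tree A) → List A
  leavesM nothing  = []
  leavesM (just t) = leaves t

  combine-leaves : ∀ m₁ m₂ → leavesM (combine m₁ m₂) ≡ leavesM m₁ ++ leavesM m₂
  combine-leaves (just l) (just r) = refl
  combine-leaves (just l) nothing  = sym (++-identityʳ _)
  combine-leaves nothing  (just r) = refl
  combine-leaves nothing  nothing  = refl

  restrict-leaves : ∀ Y t → leavesM (restrict _≟_ Y t) ≡ filter (λ a → dec∈ _≟_ a Y) (leaves t)
  restrict-leaves Y (leaf a) with dec∈ _≟_ a Y
  ... | yes _ = refl
  ... | no  _ = refl
  restrict-leaves Y (node l r) = begin
    leavesM (combine (restrict _≟_ Y l) (restrict _≟_ Y r))
      ≡⟨ combine-leaves (restrict _≟_ Y l) (restrict _≟_ Y r) ⟩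
    leavesM (restrict _≟_ Y l) ++ leavesM (restrict _≟_ Y r)
      ≡⟨ cong₂ _++_ (restrict-leaves Y l) (restrict-leaves Y r) ⟩
    filter (λ a → dec∈ _≟_ a Y) (leaves l) ++ filter (λ a → dec∈ _≟_ a Y) (leaves r)
      ≡⟨ sym (filter-++ (λ a → dec∈ _≟_ a Y) (leaves l) (leaves r)) ⟩
    filter (λ a → dec∈ _≟_ a Y) (leaves l ++ leaves r) ∎
    where open ≡-Reasoning

  restricted-leaves : ∀ Y S → restrict _≟_ Y S ≡ just S' → leaves S' ≡ filter (λ a → dec∈ _≟_ a Y) (leaves S)
  restricted-leaves Y S e = trans (cong leavesM (sym e)) (restrict-leaves Y S)

  restrict-unique : Unique (leaves t) → restrict _≟_ Y t ≡ just T → Unique (leaves T)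
  restrict-unique {t = t} {Y = Y} u e = subst Unique (sym (restricted-leaves Y t e)) (filter⁺ (λ a → dec∈ _≟_ a Y) u)

  restrict-leaf : ∀ b → restrict _≟_ Y (leaf b) ≡ just T → T ≡ leaf b
  restrict-leaf {Y = Y} b e with dec∈ _≟_ b Y
  restrict-leaf b refl | yes _ = refl
  restrict-leaf b ()   | no  _

  record Lift (Y : List A) (t : Tree A) (p : Path) (S' : Tree A) : Set where
    constructor lift
    field
      {source}  : Tree A
      at        : subtreeAt t p ≡ just source
      restricts : restrict _≟_ Y source ≡ just S'

  lift-leaves⁻ : Lift Y t p S' → a ∈ leaves S' → Under t p a × a ∈ Y
  lift-leaves⁻ {Y = Y} (lift {S} at r) m =
    ×-map₁ (under⁺ at) (∈-filter⁻ (λ a → dec∈ _≟_ a Y) (subst (_ ∈_) (restricted-leaves Y S r) m))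

  lift-leaves⁺ : Lift Y t p S' → Under t p a → a ∈ Y → a ∈ leaves S'
  lift-leaves⁺ {Y = Y} (lift {S} at r) i y =
    subst (_ ∈_) (sym (restricted-leaves Y S r)) (∈-filter⁺ (λ a → dec∈ _≟_ a Y) (under⁻ at i) y)

  Lift-into : ∀ d {l r : Tree A} → Lift Y (branch d l r) p S' → Lift Y (node l r) (d ∷ p) S'
  Lift-into L (lift at r) = lift at r
  Lift-into R (lift at r) = lift at r

  induced-node-lifts : ∀ t q → restrict _≟_ Y t ≡ just T → subtreeAt T q ≡ just S' → ∃ λ p → Lift Y t p S'
  induced-node-lifts t [] eT refl = [] , lift refl eT
  induced-node-lifts (leaf b) (d ∷ q) eT e with restrict-leaf b eT
  induced-node-lifts (leaf b) (d ∷ q) eT () | refl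
  induced-node-lifts {Y = Y} (node l r) (d ∷ q) eT e with restrict _≟_ Y l in el | restrict _≟_ Y r in er
  induced-node-lifts (node l r) (L ∷ q) refl e | just _ | just _ =
    ×-map (L ∷_) (Lift-into L) (induced-node-lifts l q el e)
  induced-node-lifts (node l r) (R ∷ q) refl e | just _ | just _ =
    ×-map (R ∷_) (Lift-into R) (induced-node-lifts r q er e)
  induced-node-lifts (node l r) (d ∷ q) refl e | just _ | nothing =
    ×-map (L ∷_) (Lift-into L) (induced-node-lifts l (d ∷ q) el e)
  induced-node-lifts (node l r) (d ∷ q) refl e | nothing | just _ =
    ×-map (R ∷_) (Lift-into R) (induced-node-lifts r (d ∷ q) er e)
  induced-node-lifts (node l r) (d ∷ q) () e | nothing | nothing

  restricted-node-lifts : ∀ t → restrict _≟_ Y t ≡ just (node l' r') →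
    ∃ λ w → Lift Y t (w ∷ʳ L) l' × Lift Y t (w ∷ʳ R) r'
  restricted-node-lifts (leaf b) e with restrict-leaf b e
  ... | ()
  restricted-node-lifts {Y = Y} (node l r) e with restrict _≟_ Y l in el | restrict _≟_ Y r in er
  restricted-node-lifts (node l r) refl | just _ | just _ = [] , lift refl el , lift refl er
  restricted-node-lifts (node l r) refl | just _ | nothing =
    ×-map (L ∷_) (×-map (Lift-into L) (Lift-into L)) (restricted-node-lifts l el)
  restricted-node-lifts (node l r) refl | nothing | just _ =
    ×-map (R ∷_) (×-map (Lift-into R) (Lift-into R)) (restricted-node-lifts r er)
  restricted-node-lifts (node l r) () | nothing | nothing

  induced-internal-node : restrict _≟_ Y t ≡ just T → subtreeAt T q ≡ just (node l' r') →
    ∃ λ w → Lift Y t (w ∷ʳ L) l' × Lift Y t (w ∷ʳ R) r'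
  induced-internal-node {Y = Y} {t = t} {q = q} eT e with induced-node-lifts t q eT e
  ... | p , lift {S} at r with restricted-node-lifts S r
  ...   | w , lift atL rL , lift atR rR = p ++ w , lift (within atL) rL , lift (within atR) rR
    where
    within : ∀ {d U} → subtreeAt S (w ∷ʳ d) ≡ just U → subtreeAt t ((p ++ w) ∷ʳ d) ≡ just U
    within {d} e′ = trans (cong (subtreeAt t) (++-assoc p w (d ∷ []))) (trans (subtreeAt-++ p at) e′)

  sibling-lifts : restrict _≟_ (x ∷ Y) t ≡ just T → SiblingOf x s T →
    ∃₂ λ pu dx → Lift (x ∷ Y) t (pu ∷ʳ dx) (leaf x) × Lift (x ∷ Y) t (pu ∷ʳ flip dx) s
  sibling-lifts {t = t} eT (q , inj₁ e) with induced-internal-node {t = t} {q = q} eT e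
  ... | w , x-side , s-side = w , L , x-side , s-side
  sibling-lifts {t = t} eT (q , inj₂ e) with induced-internal-node {t = t} {q = q} eT e
  ... | w , s-side , x-side = w , R , x-side , s-side

open Restriction

-- The node pu of T* whose children restrict to the new leaf x and to its sibling s

module SiblingNode (_≟_ : DecidableEquality A) (u : Unique (leaves t)) (x∉Y : x ∉ Y) {pu : Path} {dx : Dir}
    (x-side : Lift _≟_ (x ∷ Y) t (pu ∷ʳ dx) (leaf x))
    (s-side : Lift _≟_ (x ∷ Y) t (pu ∷ʳ flip dx) s) where

  x-under : Under t (pu ∷ʳ dx) x
  x-under = proj₁ (lift-leaves⁻ _≟_ x-side (here refl))

  x-side-avoids-Y : Under t (pu ∷ʳ dx) a → a ∉ Y
  x-side-avoids-Y i y with lift-leaves⁺ _≟_ x-side i (there y)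
  ... | here refl = x∉Y y

  s-under-pu : a ∈ leaves s → Under t pu a
  s-under-pu m = Under-parent (proj₁ (lift-leaves⁻ _≟_ s-side m))

  s-side-Y : Under t (pu ∷ʳ flip dx) a → a ∈ Y → a ∈ leaves s
  s-side-Y i y = lift-leaves⁺ _≟_ s-side i (there y)

  x-with-Y-above-pu : Under t q x → Under t q a → a ∈ Y → q ≼ pu
  x-with-Y-above-pu x∈q a∈q a∈Y with child-comparable u x-under x∈q
  ... | inj₁ pux≼q = ⊥-elim (x-side-avoids-Y (Under-mono pux≼q a∈q) a∈Y)
  ... | inj₂ q≼pu  = q≼pu

  sibling-in-branch : Under t (w ∷ʳ d) a → a ∈ Y → Under t w b →
    Under t p a → Under t p x → ¬ Under t p b → c ∈ leaves s → Under t (w ∷ʳ d) c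
  sibling-in-branch {w = w} {d = d} a∈wd a∈Y b∈w a∈p x∈p b∉p c∈s = Under-mono wd≼pu (s-under-pu c∈s)
    where
    wd≼pu : (w ∷ʳ d) ≼ pu
    wd≼pu = x-with-Y-above-pu (Under-mono (separating-cluster u a∈wd b∈w a∈p b∉p) x∈p) a∈wd a∈Y

  sibling-outside-branch : Under t (w ∷ʳ d) a → Under t (w ∷ʳ flip d) b → b ∈ Y →
    Under t p a → Under t p b → ¬ Under t p x → c ∈ leaves s →
    ¬ (∀ {c} → c ∈ leaves s → Under t (w ∷ʳ d) c)
  sibling-outside-branch {w = w} {p = p} a∈wd b∈wd̄ b∈Y a∈p b∈p x∉p c∈s s⊆wd
    with child-comparable u (s⊆wd c∈s) (s-under-pu c∈s)
  ... | inj₁ wd≼pu = x∉p (Under-mono p≼w (Under-parent (Under-mono wd≼pu (Under-parent x-under))))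
    where
    p≼w : p ≼ w
    p≼w = joint-cluster-above u a∈wd b∈wd̄ a∈p b∈p
  ... | inj₂ pu≼w with Under-sides x-under (Under-mono pu≼w (Under-parent b∈wd̄))
  ...   | inj₁ b∈pux = x-side-avoids-Y b∈pux b∈Y
  ...   | inj₂ b∈pus = branches-disjoint u (s⊆wd (s-side-Y b∈pus b∈Y)) b∈wd̄

-- Transfer to the induced tree T = T*[Y], where s is the subtree of T at pbar

module Location (_≟_ : DecidableEquality A) (u : Unique (leaves t)) (x∉Y : x ∉ Y)
    (eT : restrict _≟_ Y t ≡ just T) {pu : Path} {dx : Dir}
    (x-side : Lift _≟_ (x ∷ Y) t (pu ∷ʳ dx) (leaf x))
    (s-side : Lift _≟_ (x ∷ Y) t (pu ∷ʳ flip dx) s)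
    {pbar : Path} {tbar : Tree A} (ebar : subtreeAt T pbar ≡ just tbar)
    (s≈tbar : SameSet (leaves tbar) (leaves s)) where

  open SiblingNode _≟_ u x∉Y x-side s-side

  uT : Unique (leaves T)
  uT = restrict-unique _≟_ {t = t} u eT

  s-in-Y : c ∈ leaves s → c ∈ Y
  s-in-Y c∈s = proj₂ (lift-leaves⁻ _≟_ (proj₂ (induced-node-lifts _≟_ t pbar eT ebar)) (proj₂ s≈tbar c∈s))

  inside-lift⇒inside-node : subtreeAt T q ≡ just l → Lift _≟_ Y t p l →
    (∀ {c} → c ∈ leaves s → Under t p c) → Under T pbar c → Under T q c
  inside-lift⇒inside-node {q = q} e lift-l s⊆p c∈pbar =
    let c∈s = proj₁ s≈tbar (under⁻ ebar c∈pbar)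
    in under⁺ {p = q} e (lift-leaves⁺ _≟_ lift-l (s⊆p c∈s) (s-in-Y c∈s))

  below-node⇒inside-lift : subtreeAt T q ≡ just l → Lift _≟_ Y t p l → q ≼ pbar → c ∈ leaves s → Under t p c
  below-node⇒inside-lift {q = q} e lift-l q≼pbar c∈s =
    proj₁ (lift-leaves⁻ _≟_ lift-l (under⁻ {p = q} e (Under-mono q≼pbar (under⁺ ebar (proj₂ s≈tbar c∈s)))))

  located : ∀ d → subtreeAt T (pv ∷ʳ d) ≡ just l → Lift _≟_ Y t (w ∷ʳ d) l → Lift _≟_ Y t (w ∷ʳ flip d) r →
    a ∈ leaves l → b ∈ leaves r → Response t a x b → (pv ∷ʳ d) ≼ pbar
  located d e lift-l lift-r a∈l b∈r resp =
    let p , a∈p , x∈p , b∉p = response-cluster resp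
        a∈wd , a∈Y = lift-leaves⁻ _≟_ lift-l a∈l
        b∈w = Under-parent (proj₁ (lift-leaves⁻ _≟_ lift-r b∈r))
    in cluster-⊆⇒≼ uT ebar (inside-lift⇒inside-node e lift-l (sibling-in-branch a∈wd a∈Y b∈w a∈p x∈p b∉p))

  not-located : ∀ d → subtreeAt T (pv ∷ʳ d) ≡ just l → Lift _≟_ Y t (w ∷ʳ d) l → Lift _≟_ Y t (w ∷ʳ flip d) r →
    a ∈ leaves l → b ∈ leaves r → Response t a b x → ¬ (pv ∷ʳ d) ≼ pbar
  not-located d e lift-l lift-r a∈l b∈r resp pvd≼pbar =
    let p , a∈p , b∈p , x∉p = response-cluster resp
        a∈wd = proj₁ (lift-leaves⁻ _≟_ lift-l a∈l)
        b∈wd̄ , b∈Y = lift-leaves⁻ _≟_ lift-r b∈r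
        c₀∈s = proj₁ s≈tbar (proj₂ (some-leaf tbar))
    in sibling-outside-branch a∈wd b∈wd̄ b∈Y a∈p b∈p x∉p c₀∈s (below-node⇒inside-lift e lift-l pvd≼pbar)

proposition4 : {A : Set} (_≟_ : DecidableEquality A)
    (Tstar : Tree A) → Unique (leaves Tstar) →
    (Y : List A) → (∀ {y} → y ∈ Y → y ∈ leaves Tstar) →
    (∃₂ λ y₁ y₂ → y₁ ∈ Y × y₂ ∈ Y × y₁ ≢ y₂) →
    (x : A) → x ∈ leaves Tstar → x ∉ Y →
    (T : Tree A) → restrict _≟_ Y Tstar ≡ just T →
    (T' : Tree A) → restrict _≟_ (x ∷ Y) Tstar ≡ just T' →
    (s : Tree A) → SiblingOf x s T' →
    (pbar : Path) (tbar : Tree A) → subtreeAt T pbar ≡ just tbar →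
    SameSet (leaves tbar) (leaves s) →
    (pv : Path) (l r : Tree A) → subtreeAt T pv ≡ just (node l r) →
    (xL xR : A) → xL ∈ leaves l → xR ∈ leaves r →
    (Response Tstar xL x xR → (pv ∷ʳ L) ≼ pbar)
    × (Response Tstar xR x xL → (pv ∷ʳ R) ≼ pbar)
    × (Response Tstar xL xR x → ¬ ((pv ∷ʳ L) ≼ pbar) × ¬ ((pv ∷ʳ R) ≼ pbar))
proposition4 _≟_ t u Y _ _ x _ x∉Y T eT T' eT' s sibling pbar tbar ebar s≈tbar pv l r ev xL xR xL∈l xR∈r
  with sibling-lifts _≟_ {t = t} eT' sibling | induced-internal-node _≟_ {t = t} {q = pv} eT ev
... | pu , dx , x-side , s-side | w , lift-l , lift-r =
    located L (children-of-v L) lift-l lift-r xL∈l xR∈r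
  , located R (children-of-v R) lift-r lift-l xR∈r xL∈l
  , λ resp → not-located L (children-of-v L) lift-l lift-r xL∈l xR∈r resp
           , not-located R (children-of-v R) lift-r lift-l xR∈r xL∈l (response-swap resp)
  where
  open Location _≟_ u x∉Y eT x-side s-side {pbar = pbar} ebar s≈tbar
  children-of-v : ∀ d → subtreeAt T (pv ∷ʳ d) ≡ just (branch d l r)
  children-of-v = child-at {t = T} {p = pv} ev
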